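{- Let $b>2$ be an integer such that $b\equiv \mathfrak{b}\pmod{641}$ for some $\mathfrak b\in\{1,147,265,378\}$ and $b\not\equiv1\pmod 5$. Then there are infinitely many $b$-repunits that are Sierpiński numbers.
   Context: For $b\ge2$ and $t\ge1$, the $b$-repunit $1_b^{(t)}$ is $(b^t-1)/(b-1)$. A Sierpiński number is an odd positive integer $k$ such that $k\cdot 2^n+1$ is composite for all positive integers $n$. -}

module Defs where

open import Data.Nat using (ℕ; zero; suc; _+_; _*_; _∸_; _^_; _<_; _≤_; NonZero)
open import Data.Nat.DivMod using (_/_; _%_)
open import Data.Nat.Primality using (Composite)
open import Data.Product using (∃; _×_)

repunit : (b t : ℕ) → .{{NonZero (b ∸ 1)}} → ℕ
repunit b t = (b ^ t ∸ 1) / (b ∸ 1)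

Sierpinski : ℕ → Set
Sierpinski k = (0 < k) × (k % 2 ≡ 1) × ((n : ℕ) → 1 ≤ n → Composite (k * 2 ^ n + 1))
  where open import Relation.Binary.PropositionalEquality using (_≡_)

{-# OPTIONS --safe #-}
-- Let K = 1 + b + ⋯ + b^(t−1). As 2^64 − 1 = 3 · 5 · 17 · 257 · 65537 · 641 · 6700417, every
-- exponent n is covered: according to the 2-adic valuation j of n, the Fermat prime 2^(2^j) + 1
-- (j < 5) or 6700417 (j = 5, a factor of 2^32 + 1) divides 2^n + 1, and if 64 ∣ n then 641
-- divides 2^n − 1. Hence K · 2^n + 1 is always composite once K > 6700417, K ≡ 1 modulo the
-- first six of these primes and K ≡ −1 (mod 641).
-- By Fermat's little theorem a prime p divides b, b − 1 or 1 + b + ⋯ + b^(p−2), so K ≡ 1 (mod p)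
-- as soon as t ≡ 1 modulo p (p − 1), or just modulo p − 1 when p ∤ b − 1; the latter is how
-- b ≢ 1 (mod 5) enters. Modulo 641, K only depends on b mod 641 and on t mod 640 (mod 641 if
-- b ≡ 1), and for each admissible residue of b a single computation finds a t with K ≡ −1.
-- These conditions on t are met along an infinite arithmetic progression.
module Submission where

open import Defs
open import Level using (0ℓ)
open import Function using (_∘_)
open import Data.Bool using (if_then_else_)
open import Data.Nat
open import Data.Nat.Properties
open import Data.Nat.DivMod hiding (_mod_)
open import Data.Nat.Divisibility
open import Data.Nat.Primality
open import Data.Nat.Combinatorics using (_C_; nCn≡1; k![n∸k]!∣n!)
open import Data.Nat.Combinatorics.Specification using (nCk≡n!/k![n-k]!)
open import Data.Nat.Tactic.RingSolver using (solve-∀)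
open import Data.Fin using (zero; suc; toℕ; inject₁)
open import Data.Fin.Properties using (toℕ<n; toℕ-inject₁; toℕ-fromℕ)
open import Data.Vec.Functional using (Vector; init; last; tail)
open import Data.Product using (∃; _,_; _×_; proj₁; proj₂)
open import Data.Sum using (_⊎_; inj₁; inj₂)
open import Relation.Nullary using (¬_; Dec; ¬?; contradiction)
open import Relation.Nullary.Decidable using (True; toWitness; map′; _→-dec_; recompute)
open import Relation.Binary.Bundles using (Setoid)
open import Relation.Binary.Structures using (IsEquivalence)
open import Relation.Binary.PropositionalEquality
import Relation.Binary.Reasoning.Setoid as SetoidReasoning
import Algebra.Definitions.RawMonoid as RawMonoid
import Algebra.Properties.CommutativeSemiring.Binomial as Binomial
import Algebra.Properties.Monoid.Sum as Sum
import Algebra.Properties.Semiring.Exp as Exp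

infix 4 _≡_mod_
-- A record rather than the bare equation a % n ≡ b % n, so that a and b can be inferred
-- from a proof (_%_ is not injective).
record _≡_mod_ (a b n : ℕ) .{{_ : NonZero n}} : Set where
  constructor ≡-mod
  field rem-≡ : a % n ≡ b % n

open _≡_mod_ public

module _ {n : ℕ} .{{_ : NonZero n}} where

  ≡-mod-isEquivalence : IsEquivalence (_≡_mod n)
  ≡-mod-isEquivalence = record
    { refl  = ≡-mod refl
    ; sym   = λ a≡b → ≡-mod (sym (rem-≡ a≡b))
    ; trans = λ a≡b b≡c → ≡-mod (trans (rem-≡ a≡b) (rem-≡ b≡c))
    }

  ≡⇒≡-mod : ∀ {a b} → a ≡ b → a ≡ b mod n
  ≡⇒≡-mod refl = ≡-mod refl

  +-cong-mod : ∀ {a b c d} → a ≡ b mod n → c ≡ d mod n → a + c ≡ b + d mod n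
  +-cong-mod {a} {b} {c} {d} (≡-mod a≡b) (≡-mod c≡d) = ≡-mod (begin
    (a + c) % n           ≡⟨ %-distribˡ-+ a c n ⟩
    (a % n + c % n) % n   ≡⟨ cong₂ (λ x y → (x + y) % n) a≡b c≡d ⟩
    (b % n + d % n) % n   ≡⟨ %-distribˡ-+ b d n ⟨
    (b + d) % n           ∎)
    where open ≡-Reasoning

  *-cong-mod : ∀ {a b c d} → a ≡ b mod n → c ≡ d mod n → a * c ≡ b * d mod n
  *-cong-mod {a} {b} {c} {d} (≡-mod a≡b) (≡-mod c≡d) = ≡-mod (begin
    (a * c) % n           ≡⟨ %-distribˡ-* a c n ⟩
    (a % n * (c % n)) % n ≡⟨ cong₂ (λ x y → (x * y) % n) a≡b c≡d ⟩
    (b % n * (d % n)) % n ≡⟨ %-distribˡ-* b d n ⟨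
    (b * d) % n           ∎)
    where open ≡-Reasoning

  ^-cong-mod : ∀ {a b} → a ≡ b mod n → ∀ k → a ^ k ≡ b ^ k mod n
  ^-cong-mod a≡b zero    = ≡-mod refl
  ^-cong-mod a≡b (suc k) = *-cong-mod a≡b (^-cong-mod a≡b k)

  %-≡-mod : ∀ a → a % n ≡ a mod n
  %-≡-mod a = ≡-mod (m%n%n≡m%n a n)

  +-∣-≡-mod : ∀ a {c} → n ∣ c → a + c ≡ a mod n
  +-∣-≡-mod a n∣c = ≡-mod (%-remove-+ʳ a n∣c)

  ∣-resp-≡-mod : ∀ {a b} → a ≡ b mod n → n ∣ b → n ∣ a
  ∣-resp-≡-mod {a} {b} (≡-mod a≡b) n∣b = m%n≡0⇒n∣m a n (trans a≡b (n∣m⇒m%n≡0 b n n∣b))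

  +-≡-mod⇒∣ : ∀ a c → a + c ≡ c mod n → n ∣ a
  +-≡-mod⇒∣ a c (≡-mod a+c≡c) = ∣m+n∣m⇒∣n (divides ((a + c) / n) quotients) (n∣m*n (c / n))
    where
    open ≡-Reasoning
    rearrange : ∀ q a r → q + a + r ≡ a + (r + q)
    rearrange = solve-∀
    quotients : c / n * n + a ≡ (a + c) / n * n
    quotients = +-cancelʳ-≡ (c % n) _ _ (begin
      c / n * n + a + c % n        ≡⟨ rearrange (c / n * n) a (c % n) ⟩
      a + (c % n + c / n * n)      ≡⟨ cong (a +_) (m≡m%n+[m/n]*n c n) ⟨
      a + c                        ≡⟨ m≡m%n+[m/n]*n (a + c) n ⟩
      (a + c) % n + (a + c) / n * n ≡⟨ cong (_+ (a + c) / n * n) a+c≡c ⟩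
      c % n + (a + c) / n * n      ≡⟨ +-comm (c % n) _ ⟩
      (a + c) / n * n + c % n      ∎)

≡-mod-setoid : (n : ℕ) .{{_ : NonZero n}} → Setoid 0ℓ 0ℓ
≡-mod-setoid n = record { isEquivalence = ≡-mod-isEquivalence {n} }

module ≡-mod-Reasoning (n : ℕ) .{{_ : NonZero n}} = SetoidReasoning (≡-mod-setoid n)

repunit′ : ℕ → ℕ → ℕ
repunit′ b zero    = 0
repunit′ b (suc t) = 1 + b * repunit′ b t

repunit′-+ : ∀ b m n → repunit′ b (m + n) ≡ repunit′ b m + b ^ m * repunit′ b n
repunit′-+ b zero    n = sym (*-identityˡ _)
repunit′-+ b (suc m) n rewrite repunit′-+ b m n = shuffle b (repunit′ b m) (b ^ m) (repunit′ b n)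
  where
  shuffle : ∀ b r e s → 1 + b * (r + e * s) ≡ 1 + b * r + b * e * s
  shuffle = solve-∀

repunit′-monoʳ-∣ : ∀ b m {n} → m ∣ n → repunit′ b m ∣ repunit′ b n
repunit′-monoʳ-∣ b m (divides k refl) = multiple k
  where
  multiple : ∀ k → repunit′ b m ∣ repunit′ b (k * m)
  multiple zero    = _ ∣0
  multiple (suc k) rewrite repunit′-+ b m (k * m) =
    ∣m∣n⇒∣m+n ∣-refl (∣n⇒∣m*n (b ^ m) (multiple k))

repunit′-1 : ∀ t → repunit′ 1 t ≡ t
repunit′-1 zero    = refl
repunit′-1 (suc t) = cong suc (trans (+-identityʳ _) (repunit′-1 t))

repunit′-geometric : ∀ d t → d * repunit′ (suc d) t + 1 ≡ suc d ^ t
repunit′-geometric d zero    rewrite *-zeroʳ d = refl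
repunit′-geometric d (suc t) rewrite sym (repunit′-geometric d t) = telescope d (repunit′ (suc d) t)
  where
  telescope : ∀ d r → d * (1 + (1 + d) * r) + 1 ≡ (1 + d) * (d * r + 1)
  telescope = solve-∀

repunit≡repunit′ : ∀ d t .{{_ : NonZero d}} → repunit (suc d) t ≡ repunit′ (suc d) t
repunit≡repunit′ d t = begin
  (suc d ^ t ∸ 1) / d                   ≡⟨ cong (λ x → (x ∸ 1) / d) (repunit′-geometric d t) ⟨
  (d * repunit′ (suc d) t + 1 ∸ 1) / d  ≡⟨ cong (_/ d) (m+n∸n≡m _ 1) ⟩
  (d * repunit′ (suc d) t) / d          ≡⟨ cong (_/ d) (*-comm d _) ⟩
  (repunit′ (suc d) t * d) / d          ≡⟨ m*n/n≡m _ d ⟩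
  repunit′ (suc d) t                    ∎
  where open ≡-Reasoning

t≤repunit′ : ∀ d t → t ≤ repunit′ (suc d) t
t≤repunit′ d zero    = z≤n
t≤repunit′ d (suc t) = s≤s (≤-trans (t≤repunit′ d t) (m≤m+n _ (d * repunit′ (suc d) t)))

module _ {n : ℕ} .{{_ : NonZero n}} where

  repunit′-cong-mod : ∀ {a b} → a ≡ b mod n → ∀ t → repunit′ a t ≡ repunit′ b t mod n
  repunit′-cong-mod a≡b zero    = ≡-mod refl
  repunit′-cong-mod a≡b (suc t) = +-cong-mod (≡-mod refl) (*-cong-mod a≡b (repunit′-cong-mod a≡b t))

  repunit′-periodic : ∀ b {L} .{{_ : NonZero L}} → n ∣ repunit′ b L →
                      ∀ t → repunit′ b t ≡ repunit′ b (t % L) mod n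
  repunit′-periodic b {L} n∣r t = begin
    repunit′ b t                                             ≡⟨ cong (repunit′ b) (m≡m%n+[m/n]*n t L) ⟩
    repunit′ b (t % L + t / L * L)                           ≡⟨ repunit′-+ b (t % L) _ ⟩
    repunit′ b (t % L) + b ^ (t % L) * repunit′ b (t / L * L)
      ≈⟨ +-∣-≡-mod _ (∣n⇒∣m*n (b ^ (t % L)) (∣-trans n∣r (repunit′-monoʳ-∣ b L (n∣m*n (t / L))))) ⟩
    repunit′ b (t % L)                                       ∎
    where open ≡-mod-Reasoning n

private
  module B = Binomial +-*-commutativeSemiring
  module E = Exp +-*-semiring
  module S = Sum +-0-monoid
  module M = RawMonoid +-0-rawMonoid

  ^-as-^ : ∀ x n → x E.^ n ≡ x ^ n
  ^-as-^ x zero    = refl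
  ^-as-^ x (suc n) = cong (x *_) (^-as-^ x n)

  ×-as-* : ∀ n x → n M.× x ≡ n * x
  ×-as-* zero    x = refl
  ×-as-* (suc n) x = cong (x +_) (×-as-* n x)

∣-sum : ∀ {d n} (f : Vector ℕ n) → (∀ i → d ∣ f i) → d ∣ S.sum f
∣-sum {n = zero}  f d∣f = _ ∣0
∣-sum {n = suc n} f d∣f = ∣m∣n⇒∣m+n (d∣f zero) (∣-sum (tail f) (d∣f ∘ suc))

freshman : ∀ n .{{_ : NonZero n}} {d} .{{_ : NonZero d}} →
           (∀ {k} → 0 < k → k < n → d ∣ n C k) →
           ∀ x y → (x + y) ^ n ≡ x ^ n + y ^ n mod d
freshman n@(suc m) {d} d∣nCk x y = begin
  (x + y) ^ n                              ≡⟨ ^-as-^ (x + y) n ⟨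
  (x + y) E.^ n                            ≡⟨ B.theorem n x y ⟩
  f zero + S.sum (tail f)                  ≡⟨ cong (f zero +_) (S.sum-init-last (tail f)) ⟩
  f zero + (S.sum middle + last (tail f))  ≡⟨ cong₂ (λ u v → u + (S.sum middle + v)) first final ⟩
  y ^ n + (S.sum middle + x ^ n)           ≡⟨ shuffle (y ^ n) (S.sum middle) (x ^ n) ⟩
  x ^ n + y ^ n + S.sum middle             ≈⟨ +-∣-≡-mod (x ^ n + y ^ n) (∣-sum middle d∣middle) ⟩
  x ^ n + y ^ n                            ∎
  where
  open ≡-mod-Reasoning d
  f : Vector ℕ (suc n)
  f = B.binomialTerm x y n
  middle : Vector ℕ m
  middle = init (tail f)
  first : f zero ≡ y ^ n
  first = trans (+-identityʳ _) (trans (+-identityʳ _) (^-as-^ y n))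
  final : last (tail f) ≡ x ^ n
  final rewrite toℕ-fromℕ m | nCn≡1 n | n∸n≡0 m =
    trans (+-identityʳ _) (trans (*-identityʳ _) (^-as-^ x n))
  d∣middle : ∀ i → d ∣ middle i
  d∣middle i = subst (d ∣_) (sym (×-as-* (n C k) _)) (∣m⇒∣m*n _ (d∣nCk z<s k<n))
    where
    k = suc (toℕ (inject₁ i))
    k<n : k < n
    k<n = s<s (subst (_< m) (sym (toℕ-inject₁ i)) (toℕ<n i))
  shuffle : ∀ a b c → a + (b + c) ≡ c + a + b
  shuffle = solve-∀

n!≡nCk*k![n∸k]! : ∀ {n k} → k ≤ n → n ! ≡ (n C k) * (k ! * (n ∸ k) !)
n!≡nCk*k![n∸k]! {n} {k} k≤n = sym (begin
  (n C k) * (k ! * (n ∸ k) !)                  ≡⟨ cong (_* (k ! * (n ∸ k) !)) (nCk≡n!/k![n-k]! k≤n) ⟩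
  n ! / (k ! * (n ∸ k) !) * (k ! * (n ∸ k) !)  ≡⟨ m/n*n≡m (k![n∸k]!∣n! k≤n) ⟩
  n !                                          ∎)
  where
  open ≡-Reasoning
  instance _ = k !* (n ∸ k) !≢0

module _ {p : ℕ} (p-prime : Prime p) where
  private instance
    p-nonZero : NonZero p
    p-nonZero = prime⇒nonZero p-prime

  p∤k! : ∀ k → k < p → ¬ (p ∣ k !)
  p∤k! zero    _   p∣1 = ¬prime[1] (subst Prime (∣1⇒≡1 p∣1) p-prime)
  p∤k! (suc k) k<p p∣k! with euclidsLemma (suc k) (k !) p-prime p∣k!
  ... | inj₁ p∣1+k = <⇒≱ k<p (∣⇒≤ p∣1+k)
  ... | inj₂ p∣k!′ = p∤k! k (<-trans (n<1+n k) k<p) p∣k!′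

  p∣pCk : ∀ {k} → 0 < k → k < p → p ∣ p C k
  p∣pCk {k} 0<k k<p with euclidsLemma (p C k) (k ! * (p ∸ k) !) p-prime p∣p!
    where
    n∣n! : ∀ n .{{_ : NonZero n}} → n ∣ n !
    n∣n! (suc n) = m∣m*n (n !)
    p∣p! : p ∣ (p C k) * (k ! * (p ∸ k) !)
    p∣p! = subst (p ∣_) (n!≡nCk*k![n∸k]! (<⇒≤ k<p)) (n∣n! p)
  ... | inj₁ p∣pCk = p∣pCk
  ... | inj₂ p∣k![p∸k]! with euclidsLemma (k !) ((p ∸ k) !) p-prime p∣k![p∸k]!
  ...   | inj₁ p∣k!     = contradiction p∣k! (p∤k! k k<p)
  ...   | inj₂ p∣[p∸k]! = contradiction p∣[p∸k]! (p∤k! (p ∸ k) (∸-monoʳ-< 0<k (<⇒≤ k<p)))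

  fermat : ∀ a → a ^ p ≡ a mod p
  fermat zero    = ≡⇒≡-mod (0^n≡0 p)
    where
    0^n≡0 : ∀ n .{{_ : NonZero n}} → 0 ^ n ≡ 0
    0^n≡0 (suc n) = refl
  fermat (suc a) = begin
    suc a ^ p      ≡⟨ cong (_^ p) (+-comm 1 a) ⟩
    (a + 1) ^ p    ≈⟨ freshman p p∣pCk a 1 ⟩
    a ^ p + 1 ^ p  ≈⟨ +-cong-mod (fermat a) (≡⇒≡-mod (^-zeroˡ p)) ⟩
    a + 1          ≡⟨ +-comm a 1 ⟩
    suc a          ∎
    where open ≡-mod-Reasoning p

  fermat-repunit′ : ∀ d → p ∣ suc d * (d * repunit′ (suc d) (p ∸ 1))
  fermat-repunit′ d = +-≡-mod⇒∣ _ b (begin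
    b * (d * repunit′ b (p ∸ 1)) + b  ≡⟨ factor b d (repunit′ b (p ∸ 1)) ⟩
    b * (d * repunit′ b (p ∸ 1) + 1)  ≡⟨ cong (b *_) (repunit′-geometric d (p ∸ 1)) ⟩
    b ^ suc (p ∸ 1)                   ≡⟨ cong (b ^_) (m+[n∸m]≡n (>-nonZero⁻¹ p)) ⟩
    b ^ p                             ≈⟨ fermat b ⟩
    b                                 ∎)
    where
    open ≡-mod-Reasoning p
    b = suc d
    factor : ∀ b d r → b * (d * r) + b ≡ b * (d * r + 1)
    factor = solve-∀

  repunit′-≡1 : ∀ d s → (p ∸ 1) ∣ s → (p ∣ d → p ∣ s) → repunit′ (suc d) (suc s) ≡ 1 mod p
  repunit′-≡1 d s p∸1∣s p∣d⇒p∣s = +-∣-≡-mod 1 p∣b*r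
    where
    b = suc d
    p∣b*r : p ∣ b * repunit′ b s
    p∣b*r with euclidsLemma b _ p-prime (fermat-repunit′ d)
    ... | inj₁ p∣b = ∣m⇒∣m*n _ p∣b
    ... | inj₂ p∣d*r with euclidsLemma d _ p-prime p∣d*r
    ...   | inj₁ p∣d = ∣n⇒∣m*n b (∣-resp-≡-mod r≡s (p∣d⇒p∣s p∣d))
      where
      r≡s : repunit′ b s ≡ s mod p
      r≡s = begin
        repunit′ b s  ≈⟨ repunit′-cong-mod (+-∣-≡-mod 1 p∣d) s ⟩
        repunit′ 1 s  ≡⟨ repunit′-1 s ⟩
        s             ∎
        where open ≡-mod-Reasoning p
    ...   | inj₂ p∣r = ∣n⇒∣m*n b (∣-trans p∣r (repunit′-monoʳ-∣ b (p ∸ 1) p∸1∣s))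

rough? : ∀ m n → Dec (m Rough n)
rough? m n = map′ noSmallDivisor⇒rough rough⇒noSmallDivisor
  (allUpTo? (λ d → nonTrivial? d →-dec ¬? (d ∣? n)) m)
  where
  noSmallDivisor⇒rough : (∀ {d} → d < m → NonTrivial d → ¬ d ∣ n) → m Rough n
  noSmallDivisor⇒rough h (hasNonTrivialDivisor {divisor = d} {{nt}} d<m d∣n) =
    h d<m (recompute (nonTrivial? d) nt) d∣n
  rough⇒noSmallDivisor : m Rough n → ∀ {d} → d < m → NonTrivial d → ¬ d ∣ n
  rough⇒noSmallDivisor r d<m nt d∣n = r (hasNonTrivialDivisor {{nt}} d<m d∣n)

prime-by-trial-division : ∀ m n .{{_ : NonTrivial n}} → True (rough? m n) → True (n <? m * m) → Prime n
prime-by-trial-division m n rough n<m² = rough∧square>⇒prime (toWitness rough) (toWitness n<m²)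

module _ {n : ℕ} .{{_ : NonZero n}} where

  ^-periodic : ∀ {a L} .{{_ : NonZero L}} → a ^ L ≡ 1 mod n → ∀ k → a ^ k ≡ a ^ (k % L) mod n
  ^-periodic {a} {L} aᴸ≡1 k = begin
    a ^ k                            ≡⟨ cong (a ^_) (m≡m%n+[m/n]*n k L) ⟩
    a ^ (k % L + k / L * L)          ≡⟨ ^-distribˡ-+-* a (k % L) _ ⟩
    a ^ (k % L) * a ^ (k / L * L)    ≡⟨ cong (λ e → a ^ (k % L) * a ^ e) (*-comm (k / L) L) ⟩
    a ^ (k % L) * a ^ (L * (k / L))  ≡⟨ cong (a ^ (k % L) *_) (^-*-assoc a L (k / L)) ⟨
    a ^ (k % L) * (a ^ L) ^ (k / L)  ≈⟨ *-cong-mod {a = a ^ (k % L)} (≡-mod refl) (^-cong-mod aᴸ≡1 (k / L)) ⟩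
    a ^ (k % L) * 1 ^ (k / L)        ≡⟨ cong (a ^ (k % L) *_) (^-zeroˡ (k / L)) ⟩
    a ^ (k % L) * 1                  ≡⟨ *-identityʳ _ ⟩
    a ^ (k % L)                      ∎
    where open ≡-mod-Reasoning n

data CoveringPrime : Set where
  q₃ q₅ q₁₇ q₂₅₇ q₆₅₅₃₇ q₆₇₀₀₄₁₇ q₆₄₁ : CoveringPrime

modulus : CoveringPrime → ℕ
modulus q₃        = 3
modulus q₅        = 5
modulus q₁₇       = 17
modulus q₂₅₇      = 257
modulus q₆₅₅₃₇    = 65537
modulus q₆₇₀₀₄₁₇  = 6700417
modulus q₆₄₁      = 641

residue : CoveringPrime → ℕ
residue q₆₄₁ = 640
residue _    = 1

modulus-nonTrivial : ∀ q → NonTrivial (modulus q)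
modulus-nonTrivial q₃       = _
modulus-nonTrivial q₅       = _
modulus-nonTrivial q₁₇      = _
modulus-nonTrivial q₂₅₇     = _
modulus-nonTrivial q₆₅₅₃₇   = _
modulus-nonTrivial q₆₇₀₀₄₁₇ = _
modulus-nonTrivial q₆₄₁     = _

instance
  modulus-nonZero : ∀ {q} → NonZero (modulus q)
  modulus-nonZero {q} = nonTrivial⇒nonZero (modulus q) {{modulus-nonTrivial q}}

modulus≤6700417 : ∀ q → modulus q ≤ 6700417
modulus≤6700417 q₃        = toWitness {a? = 3 ≤? 6700417} _
modulus≤6700417 q₅        = toWitness {a? = 5 ≤? 6700417} _
modulus≤6700417 q₁₇       = toWitness {a? = 17 ≤? 6700417} _
modulus≤6700417 q₂₅₇      = toWitness {a? = 257 ≤? 6700417} _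
modulus≤6700417 q₆₅₅₃₇    = toWitness {a? = 65537 ≤? 6700417} _
modulus≤6700417 q₆₇₀₀₄₁₇  = ≤-refl
modulus≤6700417 q₆₄₁      = toWitness {a? = 641 ≤? 6700417} _

2^64≡1 : ∀ q → 2 ^ 64 ≡ 1 mod modulus q
2^64≡1 q₃       = ≡-mod refl
2^64≡1 q₅       = ≡-mod refl
2^64≡1 q₁₇      = ≡-mod refl
2^64≡1 q₂₅₇     = ≡-mod refl
2^64≡1 q₆₅₅₃₇   = ≡-mod refl
2^64≡1 q₆₇₀₀₄₁₇ = ≡-mod refl
2^64≡1 q₆₄₁     = ≡-mod refl

coveringPrime : ℕ → CoveringPrime
coveringPrime i =
  if i % 2 ≡ᵇ 1 then q₃ else
  if i % 4 ≡ᵇ 2 then q₅ else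
  if i % 8 ≡ᵇ 4 then q₁₇ else
  if i % 16 ≡ᵇ 8 then q₂₅₇ else
  if i % 32 ≡ᵇ 16 then q₆₅₅₃₇ else
  if i % 64 ≡ᵇ 32 then q₆₇₀₀₄₁₇ else q₆₄₁

coveringPrime-∣ : ∀ {i} → i < 64 → modulus (coveringPrime i) ∣ residue (coveringPrime i) * 2 ^ i + 1
coveringPrime-∣ = toWitness {a? = allUpTo? (λ i → modulus (coveringPrime i) ∣? residue (coveringPrime i) * 2 ^ i + 1) 64} _

SierpinskiCongruences : ℕ → Set
SierpinskiCongruences K = ∀ q → K ≡ residue q mod modulus q

sierpinskiCongruences⇒composite : ∀ {K} → 6700417 < K → SierpinskiCongruences K → ∀ n → Composite (K * 2 ^ n + 1)
sierpinskiCongruences⇒composite {K} 6700417<K K≡ n =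
  hasNonTrivialDivisor {{modulus-nonTrivial q}} q<K*2ⁿ+1 (∣-resp-≡-mod reduce (coveringPrime-∣ (m%n<n n 64)))
  where
  q = coveringPrime (n % 64)
  reduce : K * 2 ^ n + 1 ≡ residue q * 2 ^ (n % 64) + 1 mod modulus q
  reduce = +-cong-mod (*-cong-mod (K≡ q) (^-periodic (2^64≡1 q) n)) (≡-mod refl)
  q<K*2ⁿ+1 : modulus q < K * 2 ^ n + 1
  q<K*2ⁿ+1 = begin-strict
    modulus q    ≤⟨ modulus≤6700417 q ⟩
    6700417      <⟨ 6700417<K ⟩
    K            ≤⟨ m≤m*n K (2 ^ n) ⟩
    K * 2 ^ n    <⟨ m<m+n _ z<s ⟩
    K * 2 ^ n + 1 ∎
    where
    open ≤-Reasoning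
    instance _ = m^n≢0 2 n

sierpinskiCongruences⇒sierpinski : ∀ {K} → 6700417 < K → K ≡ 1 mod 2 → SierpinskiCongruences K → Sierpinski K
sierpinskiCongruences⇒sierpinski {K} 6700417<K K≡1 K≡ =
  <-trans z<s 6700417<K , rem-≡ K≡1 , λ n _ → sierpinskiCongruences⇒composite 6700417<K K≡ n

prime[3] : Prime 3
prime[3] = prime-by-trial-division 2 3 _ _

prime[5] : Prime 5
prime[5] = prime-by-trial-division 3 5 _ _

prime[17] : Prime 17
prime[17] = prime-by-trial-division 5 17 _ _

prime[257] : Prime 257
prime[257] = prime-by-trial-division 17 257 _ _

prime[65537] : Prime 65537
prime[65537] = prime-by-trial-division 257 65537 _ _

prime[6700417] : Prime 6700417
prime[6700417] = prime-by-trial-division 2589 6700417 _ _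

-- A is the least common multiple of p (p − 1) for p = 2, 3, 17, 257, 65537, 6700417
-- (6700416 = 2^7 · 3 · 17449); it is prime to 5 and 641. As 2^7 ∣ A, 640 · 641 divides
-- 3205 · A, so exponent c m ≡ 1 + c A modulo 640 and modulo 641.
A : ℕ
A = 65536 * 3 * 17 * 257 * 65537 * 6700417 * 17449

exponent : ℕ → ℕ → ℕ
exponent c m = suc ((c + m * 3205) * A)

m<exponent : ∀ c m → m < exponent c m
m<exponent c m = s≤s (begin
  m                      ≤⟨ m≤m*n m 3205 ⟩
  m * 3205               ≤⟨ m≤n+m (m * 3205) c ⟩
  c + m * 3205           ≤⟨ m≤m*n (c + m * 3205) A ⟩
  (c + m * 3205) * A     ∎)
  where open ≤-Reasoning

exponent-≡-mod : ∀ {L} .{{_ : NonZero L}} c m → L ∣ 3205 * A → exponent c m ≡ suc (c * A) mod L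
exponent-≡-mod c m L∣3205A = begin
  exponent c m                    ≡⟨ split c m A ⟩
  suc (c * A) + m * (3205 * A)    ≈⟨ +-∣-≡-mod (suc (c * A)) (∣n⇒∣m*n m L∣3205A) ⟩
  suc (c * A)                     ∎
  where
  open ≡-mod-Reasoning _
  split : ∀ c m A → suc ((c + m * 3205) * A) ≡ suc (c * A) + m * (3205 * A)
  split = solve-∀

repunit′-exponent-≡640 : ∀ 𝔟 c L .{{_ : NonZero L}} → 641 ∣ repunit′ 𝔟 L → L ∣ 3205 * A →
                         repunit′ 𝔟 (suc (c * A) % L) ≡ 640 mod 641 →
                         ∀ m → repunit′ 𝔟 (exponent c m) ≡ 640 mod 641
repunit′-exponent-≡640 𝔟 c L 641∣r L∣3205A r≡640 m = begin
  repunit′ 𝔟 (exponent c m)           ≈⟨ repunit′-periodic 𝔟 641∣r (exponent c m) ⟩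
  repunit′ 𝔟 (exponent c m % L)       ≡⟨ cong (repunit′ 𝔟) (rem-≡ (exponent-≡-mod c m L∣3205A)) ⟩
  repunit′ 𝔟 (suc (c * A) % L)        ≈⟨ r≡640 ⟩
  640                                 ∎
  where open ≡-mod-Reasoning 641

-- c places the exponent in a class where the repunit is −1 modulo 641: 640 mod 641 for 𝔟 = 1,
-- where the repunit is the exponent itself, and 385, 513, 257 mod 640 for 𝔟 = 147, 265, 378.
exponent-for-residue : ∀ {𝔟} → (𝔟 ≡ 1 ⊎ 𝔟 ≡ 147 ⊎ 𝔟 ≡ 265 ⊎ 𝔟 ≡ 378) →
                       ∃ λ c → ∀ m → repunit′ 𝔟 (exponent c m) ≡ 640 mod 641
exponent-for-residue (inj₁ refl) =
  440 , repunit′-exponent-≡640 1 440 641 (divides 1 refl) (m%n≡0⇒n∣m _ _ refl) (≡-mod refl)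
exponent-for-residue (inj₂ (inj₁ refl)) =
  2 , repunit′-exponent-≡640 147 2 640 (m%n≡0⇒n∣m _ _ refl) (m%n≡0⇒n∣m _ _ refl) (≡-mod refl)
exponent-for-residue (inj₂ (inj₂ (inj₁ refl))) =
  1 , repunit′-exponent-≡640 265 1 640 (m%n≡0⇒n∣m _ _ refl) (m%n≡0⇒n∣m _ _ refl) (≡-mod refl)
exponent-for-residue (inj₂ (inj₂ (inj₂ refl))) =
  3 , repunit′-exponent-≡640 378 3 640 (m%n≡0⇒n∣m _ _ refl) (m%n≡0⇒n∣m _ _ refl) (≡-mod refl)

repunit′-sierpinski : ∀ d s → A ∣ s → ¬ 5 ∣ d → repunit′ (suc d) (suc s) ≡ 640 mod 641 →
                      6700417 < suc s → Sierpinski (repunit′ (suc d) (suc s))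
repunit′-sierpinski d s A∣s 5∤d ≡640 6700417<t =
  sierpinskiCongruences⇒sierpinski (<-≤-trans 6700417<t (t≤repunit′ d (suc s)))
    (repunit′-≡1 prime[2] d s (1∣ s) (λ _ → ∣s 2 refl)) congruences
  where
  ∣s : ∀ k .{{_ : NonZero k}} → A % k ≡ 0 → k ∣ s
  ∣s k A%k≡0 = ∣-trans (m%n≡0⇒n∣m A k A%k≡0) A∣s
  congruences : SierpinskiCongruences (repunit′ (suc d) (suc s))
  congruences q₃       = repunit′-≡1 prime[3] d s (∣s 2 refl) (λ _ → ∣s 3 refl)
  congruences q₅       = repunit′-≡1 prime[5] d s (∣s 4 refl) (λ 5∣d → contradiction 5∣d 5∤d)
  congruences q₁₇      = repunit′-≡1 prime[17] d s (∣s 16 refl) (λ _ → ∣s 17 refl)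
  congruences q₂₅₇     = repunit′-≡1 prime[257] d s (∣s 256 refl) (λ _ → ∣s 257 refl)
  congruences q₆₅₅₃₇   = repunit′-≡1 prime[65537] d s (∣s 65536 refl) (λ _ → ∣s 65537 refl)
  congruences q₆₇₀₀₄₁₇ = repunit′-≡1 prime[6700417] d s (∣s 6700416 refl) (λ _ → ∣s 6700417 refl)
  congruences q₆₄₁     = ≡640

corollary3p12 : (b : ℕ) → .{{_ : NonZero (b ∸ 1)}} → 2 < b →
    (b % 641 ≡ 1 ⊎ b % 641 ≡ 147 ⊎ b % 641 ≡ 265 ⊎ b % 641 ≡ 378) →
    b % 5 ≢ 1 →
    (N : ℕ) → ∃ λ t → N < t × Sierpinski (repunit b t)
corollary3p12 b@(suc d) _ b%641 b%5≢1 N =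
  t , ≤-<-trans (m≤m+n N 6700417) m<t ,
  subst Sierpinski (sym (repunit≡repunit′ d t))
    (repunit′-sierpinski d s (n∣m*n (c + m * 3205)) 5∤d K≡640 (≤-<-trans (m≤n+m 6700417 N) m<t))
  where
  open ≡-mod-Reasoning 641
  c-spec = exponent-for-residue b%641
  c = proj₁ c-spec
  m = N + 6700417
  s = (c + m * 3205) * A
  t = suc s
  m<t : m < t
  m<t = m<exponent c m
  5∤d : ¬ 5 ∣ d
  5∤d 5∣d = b%5≢1 (rem-≡ (+-∣-≡-mod 1 5∣d))
  K≡640 : repunit′ b t ≡ 640 mod 641
  K≡640 = begin
    repunit′ b t          ≈⟨ repunit′-cong-mod (%-≡-mod b) t ⟨
    repunit′ (b % 641) t  ≈⟨ proj₂ c-spec m ⟩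
    640                   ∎
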